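{- Let $A=(a_0,a_1,a_2)$ be complex numbers with $a_0+a_1+a_2=0$, and for a non-negative integer $n$ let $c_n=\sum_{k\in\mathbb{N},\,k\preceq n}a_{u_3(k)}$. If $n\in\mathbb{N}$ is such that its base-$3$ representation does not contain the digit $2$, then \[ c_n=(-1)^{w(n)}a_{u_3(2n)}. \]
   Context: For a non-negative integer $n$, $u_3(n)$ is the sum of the base-$3$ digits of $n$ reduced modulo $3$ (a value in $\{0,1,2\}$), and $w(n)$ is the sum of the base-$3$ digits of $n$ reduced modulo $2$. Digital dominance: $k\preceq n$ means every base-$3$ digit of $k$ is at most the corresponding base-$3$ digit of $n$. (These $c_n$, $0\le n\le 3^N-1$, are the coefficients of a polynomial $P_N$ with $\sum_{n=0}^{3^N-1}a_{u_3(n)}x^n=P_N(x)\prod_{m=0}^{N-1}(1-x^{3^m})$.) -}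

module Defs where

open import Data.Nat using (ℕ; zero; suc; _≤ᵇ_; _≡ᵇ_)
open import Data.Nat.ListAction using (sum)
open import Data.Nat.DivMod using (_/_; _%_; _mod_)
open import Data.Fin using (Fin)
open import Data.Bool using (Bool; true; false; _∧_; not; if_then_else_)
open import Data.List using (List; []; _∷_; upTo; foldr)
open import Data.Bool using (T)
open import Algebra.Bundles using (CommutativeRing)
open import Level using (Level)

-- Base-3 digits of n, least significant first, no trailing (leading) zeros.
-- The fuel n is always sufficient since n / 3 < n for n > 0.
digits3-go : ℕ → ℕ → List ℕ
digits3-go zero    _ = []
digits3-go (suc f) zero = []
digits3-go (suc f) n@(suc _) = (n % 3) ∷ digits3-go f (n / 3)

digits3 : ℕ → List ℕ
digits3 n = digits3-go n n

s3 : ℕ → ℕ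
s3 n = sum (digits3 n)

u3 : ℕ → Fin 3
u3 n = s3 n mod 3

w : ℕ → ℕ
w n = s3 n % 2

domList : List ℕ → List ℕ → Bool
domList []       _        = true
domList (x ∷ xs) []       = (x ≡ᵇ 0) ∧ domList xs []
domList (x ∷ xs) (y ∷ ys) = (x ≤ᵇ y) ∧ domList xs ys

dom? : ℕ → ℕ → Bool
dom? k n = domList (digits3 k) (digits3 n)

_⪯_ : ℕ → ℕ → Set
k ⪯ n = T (dom? k n)

NoDigit2 : ℕ → Set
NoDigit2 n = T (foldr (λ d b → (not (d ≡ᵇ 2)) ∧ b) true (digits3 n))

module _ {c ℓ : Level} (R : CommutativeRing c ℓ) where
  open CommutativeRing R

  -- c_n = Σ_{k ⪯ n} a_{u3 k}; every k ⪯ n satisfies k ≤ n, so sum over k = 0..n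
  cseq : (Fin 3 → Carrier) → ℕ → Carrier
  cseq a n = foldr (λ k acc → (if dom? k n then a (u3 k) else 0#) + acc) 0# (upTo (suc n))

  signPow : ℕ → Carrier → Carrier
  signPow m x = if (m % 2) ≡ᵇ 0 then x else - x

{-# OPTIONS --safe #-}
-- For n with digits in {0,1} the sum over k ⪯ n obeys a Lucas-type recursion in the last
-- base-3 digit of n: a trailing 0 leaves it unchanged, a trailing 1 splits it into the sum for
-- n / 3 plus the same sum with every digit sum shifted by 1. Replacing a_{u₃(k)} by b(s₃(k)) for
-- an arbitrary sequence b with b(m) + b(m+1) + b(m+2) = 0 makes the shifted sum an instance of
-- the same problem, and induction gives c_n = (-1)^s b(2s) with s = s₃(n), the step being
-- b(2s) + b(2s+1) = -b(2s+2). Finally s₃(2n) = 2 s₃(n) since doubling n produces no carries.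
module Submission where

open import Defs
open import Data.Nat using (ℕ; zero; suc; _+_; _*_; _≤_; _<_; _≤ᵇ_; _≡ᵇ_; s≤s; z<s; s<s; NonZero)
open import Data.Fin using (Fin; zero; suc)
open import Level using (Level; _⊔_)
open import Algebra.Bundles using (CommutativeRing)
open import Data.Nat.Properties as ℕ using (≤-refl; ≤-trans; ≤-pred)
open import Data.Nat.DivMod
open import Data.Nat.Divisibility using (n∣m*n)
open import Data.Nat.Induction using (<-rec)
open import Data.Nat.ListAction using (sum)
open import Data.List using (List; []; _∷_; foldr; applyUpTo)
open import Data.Bool using (Bool; true; false; _∧_; not; T; if_then_else_)
open import Data.Bool.Properties using (T-∧)
open import Data.Product using (_×_; proj₁; proj₂)
open import Data.Empty using (⊥-elim)
open import Function using (_∘_; Equivalence)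
open import Relation.Binary.PropositionalEquality
  using (_≡_; refl; sym; trans; cong; cong₂; subst; module ≡-Reasoning)

0<3 : 0 < 3
0<3 = z<s

1<3 : 1 < 3
1<3 = s<s z<s

2<3 : 2 < 3
2<3 = s<s (s<s z<s)

consDigit : ℕ → List ℕ → List ℕ
consDigit zero []       = []
consDigit d    ds       = d ∷ ds

digits3-go-fuel : ∀ {f g n} → n ≤ f → n ≤ g → digits3-go f n ≡ digits3-go g n
digits3-go-fuel {zero}  {zero}  {zero} _ _ = refl
digits3-go-fuel {zero}  {suc g} {zero} _ _ = refl
digits3-go-fuel {suc f} {zero}  {zero} _ _ = refl
digits3-go-fuel {suc f} {suc g} {zero} _ _ = refl
digits3-go-fuel {suc f} {suc g} {n@(suc m)} (s≤s m≤f) (s≤s m≤g) =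
  cong (n % 3 ∷_) (digits3-go-fuel (≤-trans n/3≤m m≤f) (≤-trans n/3≤m m≤g))
  where
  n/3≤m : n / 3 ≤ m
  n/3≤m = ≤-pred (m/n<m n 3 1<3)

digits3-nonzero : ∀ n .{{_ : NonZero n}} → digits3 n ≡ n % 3 ∷ digits3 (n / 3)
digits3-nonzero n@(suc m) = cong (n % 3 ∷_) (digits3-go-fuel (≤-pred (m/n<m n 3 1<3)) ≤-refl)

digits3-+* : ∀ d q → d < 3 → .{{_ : NonZero (d + q * 3)}} → digits3 (d + q * 3) ≡ d ∷ digits3 q
digits3-+* d q d<3 = trans (digits3-nonzero (d + q * 3)) (cong₂ _∷_ remainder (cong digits3 quotient))
  where
  remainder : (d + q * 3) % 3 ≡ d
  remainder = trans ([m+kn]%n≡m%n d q 3) (m<n⇒m%n≡m d<3)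
  quotient : (d + q * 3) / 3 ≡ q
  quotient = trans (+-distrib-/-∣ʳ d (n∣m*n q)) (cong₂ _+_ (m<n⇒m/n≡0 d<3) (m*n/n≡m q 3))

digits3-expand : ∀ d q → d < 3 → digits3 (d + q * 3) ≡ consDigit d (digits3 q)
digits3-expand zero    zero    _   = refl
digits3-expand zero    (suc q) d<3 = begin
  digits3 (suc q * 3)             ≡⟨ digits3-+* 0 (suc q) d<3 ⟩
  0 ∷ digits3 (suc q)             ≡⟨ cong (0 ∷_) (digits3-nonzero (suc q)) ⟩
  consDigit 0 (_ ∷ _)             ≡⟨ cong (consDigit 0) (digits3-nonzero (suc q)) ⟨
  consDigit 0 (digits3 (suc q))   ∎
  where open ≡-Reasoning
digits3-expand (suc d) q       d<3 = digits3-+* (suc d) q d<3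

domList-consDigit : ∀ e xs d ys → domList (consDigit e xs) (consDigit d ys) ≡ (e ≤ᵇ d) ∧ domList xs ys
domList-consDigit zero    []      _       _       = refl
domList-consDigit zero    (_ ∷ _) zero    []      = refl
domList-consDigit zero    (_ ∷ _) zero    (_ ∷ _) = refl
domList-consDigit zero    (_ ∷ _) (suc _) _       = refl
domList-consDigit (suc _) _       zero    []      = refl
domList-consDigit (suc _) _       zero    (_ ∷ _) = refl
domList-consDigit (suc _) _       (suc _) _       = refl

sum-consDigit : ∀ d ds → sum (consDigit d ds) ≡ d + sum ds
sum-consDigit zero    []      = refl
sum-consDigit zero    (_ ∷ _) = refl
sum-consDigit (suc _) _       = refl

noDigit2 : List ℕ → Bool
noDigit2 = foldr (λ d b → not (d ≡ᵇ 2) ∧ b) true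

noDigit2-consDigit : ∀ d ds → noDigit2 (consDigit d ds) ≡ not (d ≡ᵇ 2) ∧ noDigit2 ds
noDigit2-consDigit zero    []      = refl
noDigit2-consDigit zero    (_ ∷ _) = refl
noDigit2-consDigit (suc _) _       = refl

dom?-expand : ∀ e k d q → e < 3 → d < 3 → dom? (e + k * 3) (d + q * 3) ≡ (e ≤ᵇ d) ∧ dom? k q
dom?-expand e k d q e<3 d<3
  rewrite digits3-expand e k e<3 | digits3-expand d q d<3 = domList-consDigit e _ d _

s3-expand : ∀ d q → d < 3 → s3 (d + q * 3) ≡ d + s3 q
s3-expand d q d<3 rewrite digits3-expand d q d<3 = sum-consDigit d _

NoDigit2-expand : ∀ d q → d < 3 → NoDigit2 (d + q * 3) → T (not (d ≡ᵇ 2)) × NoDigit2 q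
NoDigit2-expand d q d<3 nd rewrite digits3-expand d q d<3 | noDigit2-consDigit d (digits3 q) =
  Equivalence.to T-∧ nd

NoDigit2-ind : ∀ {p} (P : ℕ → Set p) → P 0 →
               (∀ q → P q → P (q * 3)) → (∀ q → P q → P (1 + q * 3)) →
               ∀ n → NoDigit2 n → P n
NoDigit2-ind P base step0 step1 = <-rec (λ n → NoDigit2 n → P n) byLastDigit
  where
  lastDigit : ∀ d q → d < 3 → NoDigit2 (d + q * 3) → (NoDigit2 q → P q) → P (d + q * 3)
  lastDigit 0 q d<3 nd ih = step0 q (ih (proj₂ (NoDigit2-expand 0 q d<3 nd)))
  lastDigit 1 q d<3 nd ih = step1 q (ih (proj₂ (NoDigit2-expand 1 q d<3 nd)))
  lastDigit 2 q d<3 nd ih = ⊥-elim (proj₁ (NoDigit2-expand 2 q d<3 nd))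
  lastDigit (suc (suc (suc _))) q (s<s (s<s (s<s ()))) nd ih

  byLastDigit : ∀ n → (∀ {m} → m < n → NoDigit2 m → P m) → NoDigit2 n → P n
  byLastDigit zero        _  _  = base
  byLastDigit n@(suc _)   ih nd = subst P (sym n≡) (lastDigit (n % 3) (n / 3) (m%n<n n 3)
    (subst NoDigit2 n≡ nd) (ih (m/n<m n 3 1<3)))
    where
    n≡ : n ≡ n % 3 + n / 3 * 3
    n≡ = m≡m%n+[m/n]*n n 3

s3-double : ∀ n → NoDigit2 n → s3 (2 * n) ≡ 2 * s3 n
s3-double = NoDigit2-ind (λ n → s3 (2 * n) ≡ 2 * s3 n) refl step0 step1
  where
  open ≡-Reasoning
  step0 : ∀ q → s3 (2 * q) ≡ 2 * s3 q → s3 (2 * (q * 3)) ≡ 2 * s3 (q * 3)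
  step0 q ih = begin
    s3 (2 * (q * 3))   ≡⟨ cong s3 (ℕ.*-assoc 2 q 3) ⟨
    s3 (2 * q * 3)     ≡⟨ s3-expand 0 (2 * q) 0<3 ⟩
    s3 (2 * q)         ≡⟨ ih ⟩
    2 * s3 q           ≡⟨ cong (2 *_) (s3-expand 0 q 0<3) ⟨
    2 * s3 (q * 3)     ∎
  step1 : ∀ q → s3 (2 * q) ≡ 2 * s3 q → s3 (2 * (1 + q * 3)) ≡ 2 * s3 (1 + q * 3)
  step1 q ih = begin
    s3 (2 * (1 + q * 3))   ≡⟨ cong s3 (trans (ℕ.*-distribˡ-+ 2 1 (q * 3)) (cong (2 +_) (sym (ℕ.*-assoc 2 q 3)))) ⟩
    s3 (2 + 2 * q * 3)     ≡⟨ s3-expand 2 (2 * q) 2<3 ⟩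
    2 + s3 (2 * q)         ≡⟨ cong (2 +_) ih ⟩
    2 + 2 * s3 q           ≡⟨ ℕ.*-distribˡ-+ 2 1 (s3 q) ⟨
    2 * (1 + s3 q)         ≡⟨ cong (2 *_) (s3-expand 1 q 1<3) ⟨
    2 * s3 (1 + q * 3)     ∎

module _ {c ℓ : Level} (R : CommutativeRing c ℓ) where
  open CommutativeRing R hiding (_*_; zero) renaming (_+_ to _⊕_; refl to ≈-refl; sym to ≈-sym; trans to ≈-trans)
  open import Algebra.Properties.Ring ring using (-‿involutive; -‿+-comm)
  open import Algebra.Properties.CommutativeSemigroup +-commutativeSemigroup using (interchange)
  open import Algebra.Properties.Group +-group using (inverseˡ-unique)
  open import Relation.Binary.Reasoning.Setoid setoid

  sumBelow : ℕ → (ℕ → Carrier) → Carrier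
  sumBelow zero    f = 0#
  sumBelow (suc n) f = f 0 ⊕ sumBelow n (f ∘ suc)

  syntax sumBelow n (λ k → e) = ∑[ k < n ] e

  foldr-applyUpTo : ∀ (F : ℕ → Carrier) h n →
    foldr (λ k acc → F k ⊕ acc) 0# (applyUpTo h n) ≡ ∑[ k < n ] F (h k)
  foldr-applyUpTo F h zero    = refl
  foldr-applyUpTo F h (suc n) = cong (F (h 0) ⊕_) (foldr-applyUpTo F (h ∘ suc) n)

  ∑-cong : ∀ n {f g : ℕ → Carrier} → (∀ k → f k ≈ g k) → ∑[ k < n ] f k ≈ ∑[ k < n ] g k
  ∑-cong zero    f≈g = ≈-refl
  ∑-cong (suc n) f≈g = +-cong (f≈g 0) (∑-cong n (f≈g ∘ suc))

  ∑-zero : ∀ n → ∑[ k < n ] 0# ≈ 0#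
  ∑-zero zero    = ≈-refl
  ∑-zero (suc n) = ≈-trans (+-identityˡ _) (∑-zero n)

  ∑-distrib-+ : ∀ n (f g : ℕ → Carrier) → ∑[ k < n ] (f k ⊕ g k) ≈ ∑[ k < n ] f k ⊕ ∑[ k < n ] g k
  ∑-distrib-+ zero    f g = ≈-sym (+-identityʳ 0#)
  ∑-distrib-+ (suc n) f g = ≈-trans (+-congˡ (∑-distrib-+ n (f ∘ suc) (g ∘ suc))) (interchange _ _ _ _)

  ∑-snoc : ∀ n (f : ℕ → Carrier) → ∑[ k < suc n ] f k ≈ ∑[ k < n ] f k ⊕ f n
  ∑-snoc zero    f = ≈-trans (+-identityʳ _) (≈-sym (+-identityˡ _))
  ∑-snoc (suc n) f = ≈-trans (+-congˡ (∑-snoc n (f ∘ suc))) (≈-sym (+-assoc _ _ _))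

  ∑-snoc-zero : ∀ n (f : ℕ → Carrier) → f n ≈ 0# → ∑[ k < suc n ] f k ≈ ∑[ k < n ] f k
  ∑-snoc-zero n f fn≈0 = ≈-trans (∑-snoc n f) (≈-trans (+-congˡ fn≈0) (+-identityʳ _))

  ∑-blocks3 : ∀ m (f : ℕ → Carrier) →
    ∑[ k < m * 3 ] f k ≈ ∑[ k < m ] (f (k * 3) ⊕ (f (1 + k * 3) ⊕ f (2 + k * 3)))
  ∑-blocks3 zero    f = ≈-refl
  ∑-blocks3 (suc m) f = begin
    f 0 ⊕ (f 1 ⊕ (f 2 ⊕ ∑[ k < m * 3 ] f (3 + k)))
      ≈⟨ ≈-trans (+-assoc _ _ _) (+-congˡ (+-assoc _ _ _)) ⟨
    (f 0 ⊕ (f 1 ⊕ f 2)) ⊕ ∑[ k < m * 3 ] f (3 + k)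
      ≈⟨ +-congˡ (∑-blocks3 m (f ∘ (3 +_))) ⟩
    (f 0 ⊕ (f 1 ⊕ f 2)) ⊕ ∑[ k < m ] (f (3 + k * 3) ⊕ (f (4 + k * 3) ⊕ f (5 + k * 3)))
      ∎

  ∑-pad : ∀ d q (f : ℕ → Carrier) → d < 3 →
    (∀ e → e < 3 → (e ≤ᵇ d) ≡ false → f (e + q * 3) ≈ 0#) →
    ∑[ k < suc (d + q * 3) ] f k ≈ ∑[ k < suc q * 3 ] f k
  ∑-pad 0 q f _ beyond = ≈-sym (≈-trans (∑-snoc-zero (2 + q * 3) f (beyond 2 2<3 refl))
                                        (∑-snoc-zero (1 + q * 3) f (beyond 1 1<3 refl)))
  ∑-pad 1 q f _ beyond = ≈-sym (∑-snoc-zero (2 + q * 3) f (beyond 2 2<3 refl))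
  ∑-pad 2 q f _ beyond = ≈-refl
  ∑-pad (suc (suc (suc _))) q f (s<s (s<s (s<s ()))) beyond

  when : Bool → Carrier → Carrier
  when b x = if b then x else 0#

  when-∧ : ∀ a b x → when (a ∧ b) x ≡ when a (when b x)
  when-∧ true  b x = refl
  when-∧ false b x = refl

  when-cong : ∀ b {x y} → x ≈ y → when b x ≈ when b y
  when-cong true  x≈y = x≈y
  when-cong false x≈y = ≈-refl

  ∑-when : ∀ n b (f : ℕ → Carrier) → ∑[ k < n ] when b (f k) ≈ when b (∑[ k < n ] f k)
  ∑-when n true  f = ≈-refl
  ∑-when n false f = ∑-zero n

  domSum : ℕ → (ℕ → Carrier) → Carrier
  domSum n g = ∑[ k < suc n ] when (dom? k n) (g k)

  domSum-cong : ∀ n {g h : ℕ → Carrier} → (∀ k → g k ≈ h k) → domSum n g ≈ domSum n h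
  domSum-cong n g≈h = ∑-cong (suc n) (λ k → when-cong (dom? k n) (g≈h k))

  domSum-expand : ∀ d q (g : ℕ → Carrier) → d < 3 →
    domSum (d + q * 3) g ≈ when (0 ≤ᵇ d) (domSum q (λ k → g (k * 3)))
                         ⊕ (when (1 ≤ᵇ d) (domSum q (λ k → g (1 + k * 3)))
                         ⊕  when (2 ≤ᵇ d) (domSum q (λ k → g (2 + k * 3))))
  domSum-expand d q g d<3 = begin
    ∑[ k < suc (d + q * 3) ] F k
      ≈⟨ ∑-pad d q F d<3 beyond ⟩
    ∑[ k < suc q * 3 ] F k
      ≈⟨ ∑-blocks3 (suc q) F ⟩
    ∑[ k < suc q ] (F (k * 3) ⊕ (F (1 + k * 3) ⊕ F (2 + k * 3)))
      ≈⟨ ∑-cong (suc q) (λ k → +-cong (reflexive (digit 0 k 0<3))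
                                 (+-cong (reflexive (digit 1 k 1<3)) (reflexive (digit 2 k 2<3)))) ⟩
    ∑[ k < suc q ] (H 0 k ⊕ (H 1 k ⊕ H 2 k))
      ≈⟨ ≈-trans (∑-distrib-+ (suc q) (H 0) (λ k → H 1 k ⊕ H 2 k))
                 (+-congˡ (∑-distrib-+ (suc q) (H 1) (H 2))) ⟩
    ∑[ k < suc q ] H 0 k ⊕ (∑[ k < suc q ] H 1 k ⊕ ∑[ k < suc q ] H 2 k)
      ≈⟨ +-cong (∑-when (suc q) (0 ≤ᵇ d) (G 0))
                (+-cong (∑-when (suc q) (1 ≤ᵇ d) (G 1)) (∑-when (suc q) (2 ≤ᵇ d) (G 2))) ⟩
    when (0 ≤ᵇ d) (domSum q (λ k → g (k * 3)))
      ⊕ (when (1 ≤ᵇ d) (domSum q (λ k → g (1 + k * 3))) ⊕ when (2 ≤ᵇ d) (domSum q (λ k → g (2 + k * 3))))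
      ∎
    where
    F : ℕ → Carrier
    F k = when (dom? k (d + q * 3)) (g k)
    G : ℕ → ℕ → Carrier
    G e k = when (dom? k q) (g (e + k * 3))
    H : ℕ → ℕ → Carrier
    H e k = when (e ≤ᵇ d) (G e k)
    digit : ∀ e k → e < 3 → F (e + k * 3) ≡ H e k
    digit e k e<3 = trans (cong (λ b → when b (g (e + k * 3))) (dom?-expand e k d q e<3 d<3))
                          (when-∧ (e ≤ᵇ d) (dom? k q) _)
    beyond : ∀ e → e < 3 → (e ≤ᵇ d) ≡ false → F (e + q * 3) ≈ 0#
    beyond e e<3 e≰d = reflexive (trans (digit e q e<3) (cong (λ b → when b (G e q)) e≰d))

  domSum-digit0 : ∀ q (g : ℕ → Carrier) → domSum (q * 3) g ≈ domSum q (λ k → g (k * 3))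
  domSum-digit0 q g = ≈-trans (domSum-expand 0 q g 0<3) (≈-trans (+-congˡ (+-identityʳ 0#)) (+-identityʳ _))

  domSum-digit1 : ∀ q (g : ℕ → Carrier) →
    domSum (1 + q * 3) g ≈ domSum q (λ k → g (k * 3)) ⊕ domSum q (λ k → g (1 + k * 3))
  domSum-digit1 q g = ≈-trans (domSum-expand 1 q g 1<3) (+-congˡ (+-identityʳ _))

  signPow-%2 : ∀ m x → signPow R (m % 2) x ≡ signPow R m x
  signPow-%2 m x = cong (λ r → if r ≡ᵇ 0 then x else - x) (m%n%n≡m%n m 2)

  -- `(2 + m) % 2` reduces to `m % 2`, so signPow is 2-periodic by definition.
  signPow-cong : ∀ m {x y} → x ≈ y → signPow R m x ≈ signPow R m y
  signPow-cong 0             x≈y = x≈y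
  signPow-cong 1             x≈y = -‿cong x≈y
  signPow-cong (suc (suc m)) x≈y = signPow-cong m x≈y

  signPow-suc : ∀ m x → signPow R (suc m) x ≈ signPow R m (- x)
  signPow-suc 0             x = ≈-refl
  signPow-suc 1             x = ≈-sym (-‿involutive x)
  signPow-suc (suc (suc m)) x = signPow-suc m x

  signPow-+ : ∀ m x y → signPow R m x ⊕ signPow R m y ≈ signPow R m (x ⊕ y)
  signPow-+ 0             x y = ≈-refl
  signPow-+ 1             x y = -‿+-comm x y
  signPow-+ (suc (suc m)) x y = signPow-+ m x y

  cseq≡domSum : ∀ (a : Fin 3 → Carrier) n → cseq R a n ≡ domSum n (λ k → a (u3 k))
  cseq≡domSum a n = foldr-applyUpTo (λ k → when (dom? k n) (a (u3 k))) (λ k → k) (suc n)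

  ThreeTermZero : (ℕ → Carrier) → Set ℓ
  ThreeTermZero b = ∀ m → b m ⊕ b (1 + m) ⊕ b (2 + m) ≈ 0#

  -- As with signPow, `(3 + m) mod 3` reduces to `m mod 3`, which makes the last clause typecheck.
  threeTermZero-mod3 : ∀ (a : Fin 3 → Carrier) → a zero ⊕ a (suc zero) ⊕ a (suc (suc zero)) ≈ 0# →
                       ThreeTermZero (λ m → a (m mod 3))
  threeTermZero-mod3 a a-sum 0 = a-sum
  threeTermZero-mod3 a a-sum 1 = ≈-trans (+-comm _ _) (≈-trans (≈-sym (+-assoc _ _ _)) a-sum)
  threeTermZero-mod3 a a-sum 2 = ≈-trans (+-assoc _ _ _) (≈-trans (+-comm _ _) a-sum)
  threeTermZero-mod3 a a-sum (suc (suc (suc m))) = threeTermZero-mod3 a a-sum m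

  domSum-digitSum : ∀ n → NoDigit2 n → ∀ b → ThreeTermZero b →
                    domSum n (b ∘ s3) ≈ signPow R (s3 n) (b (2 * s3 n))
  domSum-digitSum = NoDigit2-ind P (λ b _ → +-identityʳ _) step0 step1
    where
    P : ℕ → Set (c ⊔ ℓ)
    P n = ∀ b → ThreeTermZero b → domSum n (b ∘ s3) ≈ signPow R (s3 n) (b (2 * s3 n))

    step0 : ∀ q → P q → P (q * 3)
    step0 q ih b b-zero = begin
      domSum (q * 3) (b ∘ s3)
        ≈⟨ domSum-digit0 q (b ∘ s3) ⟩
      domSum q (λ k → b (s3 (k * 3)))
        ≈⟨ domSum-cong q (λ k → reflexive (cong b (s3-expand 0 k 0<3))) ⟩
      domSum q (b ∘ s3)
        ≈⟨ ih b b-zero ⟩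
      signPow R (s3 q) (b (2 * s3 q))
        ≡⟨ cong (λ s → signPow R s (b (2 * s))) (s3-expand 0 q 0<3) ⟨
      signPow R (s3 (q * 3)) (b (2 * s3 (q * 3)))
        ∎

    step1 : ∀ q → P q → P (1 + q * 3)
    step1 q ih b b-zero = begin
      domSum (1 + q * 3) (b ∘ s3)
        ≈⟨ domSum-digit1 q (b ∘ s3) ⟩
      domSum q (λ k → b (s3 (k * 3))) ⊕ domSum q (λ k → b (s3 (1 + k * 3)))
        ≈⟨ +-cong (domSum-cong q (λ k → reflexive (cong b (s3-expand 0 k 0<3))))
                  (domSum-cong q (λ k → reflexive (cong b (s3-expand 1 k 1<3)))) ⟩
      domSum q (b ∘ s3) ⊕ domSum q (b ∘ suc ∘ s3)
        ≈⟨ +-cong (ih b b-zero) (ih (b ∘ suc) (b-zero ∘ suc)) ⟩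
      signPow R s (b (2 * s)) ⊕ signPow R s (b (1 + 2 * s))
        ≈⟨ signPow-+ s _ _ ⟩
      signPow R s (b (2 * s) ⊕ b (1 + 2 * s))
        ≈⟨ signPow-cong s (inverseˡ-unique _ _ (b-zero (2 * s))) ⟩
      signPow R s (- b (2 + 2 * s))
        ≈⟨ signPow-suc s _ ⟨
      signPow R (1 + s) (b (2 + 2 * s))
        ≡⟨ cong (signPow R (1 + s) ∘ b) (ℕ.*-distribˡ-+ 2 1 s) ⟨
      signPow R (1 + s) (b (2 * (1 + s)))
        ≡⟨ cong (λ t → signPow R t (b (2 * t))) (s3-expand 1 q 1<3) ⟨
      signPow R (s3 (1 + q * 3)) (b (2 * s3 (1 + q * 3)))
        ∎
      where
      s : ℕ
      s = s3 q

corollary3p7 : {c ℓ : Level} (R : CommutativeRing c ℓ) →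
    (a : Fin 3 → CommutativeRing.Carrier R) →
    CommutativeRing._≈_ R
      (CommutativeRing._+_ R (CommutativeRing._+_ R (a zero) (a (suc zero))) (a (suc (suc zero))))
      (CommutativeRing.0# R) →
    (n : ℕ) → NoDigit2 n →
    CommutativeRing._≈_ R (cseq R a n) (signPow R (w n) (a (u3 (2 * n))))
corollary3p7 R a a-sum n nd = begin
  cseq R a n                          ≡⟨ cseq≡domSum R a n ⟩
  domSum R n (b ∘ s3)                 ≈⟨ domSum-digitSum R n nd b (threeTermZero-mod3 R a a-sum) ⟩
  signPow R (s3 n) (b (2 * s3 n))     ≡⟨ cong (signPow R (s3 n) ∘ b) (s3-double n nd) ⟨
  signPow R (s3 n) (a (u3 (2 * n)))   ≡⟨ signPow-%2 R (s3 n) _ ⟨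
  signPow R (w n) (a (u3 (2 * n)))    ∎
  where
  open CommutativeRing R using (Carrier; setoid)
  open import Relation.Binary.Reasoning.Setoid setoid
  b : ℕ → Carrier
  b m = a (m mod 3)
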